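{- Let $G=(P,N,E)$ be a proper tagged probe interval graph such that $G_P$ is a connected reduced proper interval graph, and let $S$ be a canonical sequence of $G_P$. Then for any nonprobe vertex $w\in N$, there cannot exist more than one disjoint perfect substring of $w$ in $S$, unless the substring consists of a single element; i.e., there do not exist two perfect substrings of $w$ in $S$ occupying disjoint sets of positions and each of length greater than $1$.
   Context: $G_P$ is the subgraph induced by the probe set $P$. A proper tagged probe interval graph with probes $P$ and nonprobes $N$ is a graph for which there are closed intervals $I_x=[\ell_x,r_x]$ such that $N$ is independent; for $x,y\in P$, $xy\in E$ iff $I_x\cap I_y\ne\emptyset$; for $x\in P,y\in N$, $xy\in E$ iff $\ell_x\in I_y$ or $r_x\in I_y$; and $\{I_x:x\in P\}$ is a proper interval representation of $G_P$ (no interval properly contains another). A graph is reduced if no two vertices have the same closed neighborhood. A canonical ordering of a proper interval graph is an ordering $v_1,\dots,v_n$ of its vertices with a proper interval representation $\{[a_i,b_i]\}$ satisfying $a_i\ne b_j$ for all $i,j$, $a_1<\dots<a_n$, $b_1<\dots<b_n$; the canonical sequence lists the $2n$ endpoints in increasing order with $a_i,b_i$ replaced by $i$ (identified with vertex $v_i$). A substring is a contiguous stretch of the sequence. A perfect substring of $w\in N$ is a substring all of whose entries are neighbors of $w$ and which contains every neighbor of $w$ in $P$ at least once. -}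

module Defs where

open import Data.Nat using (ℕ; _≤_; _<_; _+_)
open import Data.Fin using (Fin; toℕ) renaming (_<_ to _<ᶠ_)
open import Data.Sum using (_⊎_; inj₁; inj₂)
open import Data.Product using (Σ; _×_; _,_; proj₁; proj₂; ∃; ∃-syntax)
open import Data.Bool using (Bool; true; false)
open import Relation.Binary.PropositionalEquality using (_≡_; _≢_)
open import Relation.Nullary using (¬_)
open import Function.Bundles using (_⇔_; _⤖_; Bijection)
open import Relation.Binary.Construct.Closure.ReflexiveTransitive using (Star)

-- Vertex set of G = (P, N, E): probes P = Fin p, nonprobes N = Fin q.
Vertex : ℕ → ℕ → Set
Vertex p q = Fin p ⊎ Fin q

record SimpleGraph (V : Set) : Set₁ where
  field
    Adj    : V → V → Set
    sym    : ∀ {x y} → Adj x y → Adj y x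
    irrefl : ∀ {x} → ¬ Adj x x
open SimpleGraph public

-- Closed intervals [ℓ , r] with endpoints in ℕ (only the relative order of
-- finitely many endpoints matters).
Interval : Set
Interval = ℕ × ℕ

left : Interval → ℕ
left = proj₁

right : Interval → ℕ
right = proj₂

IsInterval : Interval → Set
IsInterval I = left I ≤ right I

_∈ᵢ_ : ℕ → Interval → Set
t ∈ᵢ I = left I ≤ t × t ≤ right I

Intersect : Interval → Interval → Set
Intersect I J = left I ≤ right J × left J ≤ right I

_⊊ᵢ_ : Interval → Interval → Set
I ⊊ᵢ J = (left J ≤ left I × right I ≤ right J) × I ≢ J

ProbeAdj : ∀ {p q} → SimpleGraph (Vertex p q) → Fin p → Fin p → Set
ProbeAdj G x y = Adj G (inj₁ x) (inj₁ y)

IsProperIntervalRep : ∀ {p} → (Fin p → Fin p → Set) → (Fin p → Interval) → Set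
IsProperIntervalRep {p} A I =
  (∀ x → IsInterval (I x)) ×
  (∀ x y → x ≢ y → (A x y ⇔ Intersect (I x) (I y))) ×
  (∀ x y → ¬ (I x ⊊ᵢ I y))

IsProperTaggedProbeRep : ∀ {p q} → SimpleGraph (Vertex p q) → (Vertex p q → Interval) → Set
IsProperTaggedProbeRep {p} {q} G I =
  (∀ v → IsInterval (I v)) ×
  (∀ (y z : Fin q) → ¬ Adj G (inj₂ y) (inj₂ z)) ×
  (∀ (x y : Fin p) → x ≢ y →
     (Adj G (inj₁ x) (inj₁ y) ⇔ Intersect (I (inj₁ x)) (I (inj₁ y)))) ×
  (∀ (x : Fin p) (y : Fin q) →
     (Adj G (inj₁ x) (inj₂ y) ⇔
       (left (I (inj₁ x)) ∈ᵢ I (inj₂ y) ⊎ right (I (inj₁ x)) ∈ᵢ I (inj₂ y)))) ×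
  IsProperIntervalRep (ProbeAdj G) (λ x → I (inj₁ x))

IsProperTaggedProbeIntervalGraph : ∀ {p q} → SimpleGraph (Vertex p q) → Set
IsProperTaggedProbeIntervalGraph {p} {q} G =
  Σ (Vertex p q → Interval) (IsProperTaggedProbeRep G)

Connected : ∀ {p} → (Fin p → Fin p → Set) → Set
Connected A = ∀ x y → Star A x y

ClosedNbhd : ∀ {p} → (Fin p → Fin p → Set) → Fin p → Fin p → Set
ClosedNbhd A x z = z ≡ x ⊎ A x z

Reduced : ∀ {p} → (Fin p → Fin p → Set) → Set
Reduced A = ∀ x y → (∀ z → (ClosedNbhd A x z ⇔ ClosedNbhd A y z)) → x ≡ y

-- σ i is the vertex v_i; I is indexed by vertices, so [a_i , b_i] = I (σ i).
IsCanonicalOrdering : ∀ {p} → (Fin p → Fin p → Set) → (Fin p → Fin p) → (Fin p → Interval) → Set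
IsCanonicalOrdering A σ I =
  IsProperIntervalRep A I ×
  (∀ x y → left (I x) ≢ right (I y)) ×
  (∀ i j → i <ᶠ j → left (I (σ i)) < left (I (σ j))) ×
  (∀ i j → i <ᶠ j → right (I (σ i)) < right (I (σ j)))

endpoint : ∀ {p} → (Fin p → Interval) → Fin p × Bool → ℕ
endpoint I (x , true)  = left (I x)
endpoint I (x , false) = right (I x)

-- S is a canonical sequence of the graph with adjacency A: the list (indexed by
-- positions 0 .. 2p-1) of the 2p endpoints of a canonical ordering's
-- representation in increasing order, each endpoint replaced by its vertex.
IsCanonicalSequence : ∀ {p} → (Fin p → Fin p → Set) → (Fin (p + p) → Fin p) → Set
IsCanonicalSequence {p} A S =
  Σ (Fin p → Fin p) λ σ → Σ (Fin p → Interval) λ I →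
  IsCanonicalOrdering A σ I ×
  Σ (Fin (p + p) ⤖ (Fin p × Bool)) λ e →
    (∀ k → S k ≡ proj₁ (Bijection.to e k)) ×
    (∀ k k' → k <ᶠ k' → endpoint I (Bijection.to e k) < endpoint I (Bijection.to e k'))

InRange : ∀ {m} → ℕ → ℕ → Fin m → Set
InRange s l k = s ≤ toℕ k × toℕ k < s + l

IsPerfectSubstring : ∀ {p q} → SimpleGraph (Vertex p q) → (Fin (p + p) → Fin p) →
                     Fin q → ℕ → ℕ → Set
IsPerfectSubstring {p} G S w s l =
  s + l ≤ p + p ×
  (∀ k → InRange s l k → Adj G (inj₁ (S k)) (inj₂ w)) ×
  (∀ x → Adj G (inj₁ x) (inj₂ w) → ∃[ k ] (InRange s l k × S k ≡ x))

DisjointRanges : ℕ → ℕ → ℕ → ℕ → Set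
DisjointRanges s1 l1 s2 l2 = s1 + l1 ≤ s2 ⊎ s2 + l2 ≤ s1

-- Every vertex of G_P occurs in S exactly twice, first for its left and then for its
-- right endpoint.  If two disjoint substrings both consist of neighbours of w and
-- contain all of them, each neighbour occurs in both, so every entry of the earlier
-- substring is a left endpoint and every entry of the later one a right endpoint.
-- The first two entries x, y of the earlier substring then have consecutive left
-- endpoints, and their right endpoints are separated only by right endpoints; hence
-- an interval meets I x iff it meets I y, so x and y have the same closed
-- neighbourhood, contradicting reducedness.
module Submission where

open import Defs hiding (sym)
open import Data.Nat using (ℕ; suc; _+_; _≤_; _<_; s≤s⁻¹; z<s)
open import Data.Nat.Properties
  using (≤-refl; ≤-trans; <-≤-trans; n≤1+n; <-trans; <⇒≤; <⇒≱; ≮⇒≥; <-irrefl; <-asym; <-cmp;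
         ≤∧≢⇒<; n<1+n; m<m+n; +-comm; +-monoʳ-<)
open import Data.Fin using (Fin; toℕ; fromℕ<; _≟_) renaming (_<_ to _<ᶠ_)
open import Data.Fin.Properties using (toℕ-injective; toℕ-fromℕ<)
open import Data.Product using (_×_; ∃-syntax; Σ; _,_; proj₁; proj₂)
open import Data.Sum using (_⊎_; inj₁; inj₂)
open import Data.Bool using (Bool; true; false)
open import Data.Empty using (⊥-elim)
open import Relation.Nullary using (¬_; yes; no)
open import Relation.Binary using (tri<; tri≈; tri>)
open import Relation.Binary.PropositionalEquality
  using (_≡_; _≢_; refl; sym; trans; cong; cong₂; subst; subst₂)
open import Function using (_∘_)
open import Function.Bundles using (_⇔_; _⤖_; Bijection; mk⇔; Equivalence)

true≢false : true ≢ false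
true≢false ()

StrictlyBetween : ℕ → ℕ → ℕ → Set
StrictlyBetween t u v = (u < t × t < v) ⊎ (v < t × t < u)

StrictlyBetween-sym : ∀ {t u v} → StrictlyBetween t u v → StrictlyBetween t v u
StrictlyBetween-sym (inj₁ b) = inj₂ b
StrictlyBetween-sym (inj₂ b) = inj₁ b

¬StrictlyBetween-suc : ∀ {t n} → ¬ StrictlyBetween t n (suc n)
¬StrictlyBetween-suc (inj₁ (n<t , t<1+n)) = <⇒≱ n<t (s≤s⁻¹ t<1+n)
¬StrictlyBetween-suc {n = n} (inj₂ (1+n<t , t<n)) = <-asym (<-trans (n<1+n n) 1+n<t) t<n

inRange-between : ∀ {m s l} {i j j' : Fin m} → InRange s l j → InRange s l j' →
                  StrictlyBetween (toℕ i) (toℕ j) (toℕ j') → InRange s l i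
inRange-between (s≤j , _) (_ , j'<s+l) (inj₁ (j<i , i<j')) = ≤-trans s≤j (<⇒≤ j<i) , <-trans i<j' j'<s+l
inRange-between (_ , j<s+l) (s≤j' , _) (inj₂ (j'<i , i<j)) = ≤-trans s≤j' (<⇒≤ j'<i) , <-trans i<j j<s+l

inRange-fromℕ< : ∀ {n s l i} → s ≤ i → i < s + l → s + l ≤ n →
                 Σ (Fin n) λ k → InRange s l k × toℕ k ≡ i
inRange-fromℕ< {s = s} {l} s≤i i<s+l bound =
  fromℕ< i<n , subst (λ j → s ≤ j × j < s + l) (sym (toℕ-fromℕ< i<n)) (s≤i , i<s+l) , toℕ-fromℕ< i<n
  where i<n = <-≤-trans i<s+l bound

leading-pair : ∀ {n s l} → 1 < l → s + l ≤ n →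
               Σ (Fin n) λ k → Σ (Fin n) λ k' → InRange s l k × InRange s l k' × toℕ k' ≡ suc (toℕ k)
leading-pair {s = s} {l} 1<l bound =
  let (k , rk , k≡s) = inRange-fromℕ< ≤-refl (m<m+n s (<-trans z<s 1<l)) bound
      (k' , rk' , k'≡1+s) = inRange-fromℕ< (n≤1+n s) 1+s<s+l bound
  in k , k' , rk , rk' , trans k'≡1+s (cong suc (sym k≡s))
  where 1+s<s+l = subst (_< s + l) (+-comm s 1) (+-monoʳ-< s 1<l)

Covers : ∀ {n m} → (Fin n → Fin m) → (Fin m → Set) → ℕ → ℕ → Set
Covers S Nb s l = (∀ k → InRange s l k → Nb (S k)) × (∀ x → Nb x → ∃[ k ] (InRange s l k × S k ≡ x))

Covers-cong : ∀ {n m} {S S' : Fin n → Fin m} {Nb s l} →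
              (∀ k → S k ≡ S' k) → Covers S Nb s l → Covers S' Nb s l
Covers-cong {Nb = Nb} S≗S' (within , hits) =
  (λ k r → subst Nb (S≗S' k) (within k r)) ,
  (λ x nx → let (k , r , Sk≡x) = hits x nx in k , r , trans (sym (S≗S' k)) Sk≡x)

EndpointTwins : ∀ {p} → (Fin p → Interval) → Fin p → Fin p → Set
EndpointTwins I x y =
  (∀ z → ¬ StrictlyBetween (right (I z)) (left (I x)) (left (I y))) ×
  (∀ z → ¬ StrictlyBetween (left (I z)) (right (I x)) (right (I y)))

EndpointTwins-sym : ∀ {p} {I : Fin p → Interval} {x y} → EndpointTwins I x y → EndpointTwins I y x
EndpointTwins-sym (noRight , noLeft) =
  (λ z → noRight z ∘ StrictlyBetween-sym) , (λ z → noLeft z ∘ StrictlyBetween-sym)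

module IntervalTwins {p} {A : Fin p → Fin p → Set} {I : Fin p → Interval}
  (isInterval : ∀ x → IsInterval (I x))
  (adj⇔intersect : ∀ x y → x ≢ y → (A x y ⇔ Intersect (I x) (I y)))
  (distinctEnds : ∀ x y → left (I x) ≢ right (I y)) where

  intersect-transfer : ∀ {x y z} → EndpointTwins I x y →
                       Intersect (I x) (I z) → Intersect (I y) (I z)
  intersect-transfer {x} {y} {z} (noRight , noLeft) (ax≤bz , az≤bx) =
    ≮⇒≥ (λ bz<ay → noRight z (inj₁ (≤∧≢⇒< ax≤bz (distinctEnds x z) , bz<ay))) ,
    ≮⇒≥ (λ by<az → noLeft z (inj₂ (by<az , ≤∧≢⇒< az≤bx (distinctEnds z x))))

  closedNbhd⇒intersect : ∀ {x z} → ClosedNbhd A x z → Intersect (I x) (I z)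
  closedNbhd⇒intersect {x} (inj₁ refl) = isInterval x , isInterval x
  closedNbhd⇒intersect {x} {z} (inj₂ a) with z ≟ x
  ... | yes refl = isInterval x , isInterval x
  ... | no z≢x = Equivalence.to (adj⇔intersect x z (λ x≡z → z≢x (sym x≡z))) a

  closedNbhd-transfer : ∀ {x y z} → EndpointTwins I x y → ClosedNbhd A x z → ClosedNbhd A y z
  closedNbhd-transfer {y = y} {z} twins n with z ≟ y
  ... | yes z≡y = inj₁ z≡y
  ... | no z≢y = inj₂ (Equivalence.from (adj⇔intersect y z (λ y≡z → z≢y (sym y≡z)))
                                       (intersect-transfer twins (closedNbhd⇒intersect n)))

  twins-equal : Reduced A → ∀ {x y} → EndpointTwins I x y → x ≡ y
  twins-equal reduced {x} {y} twins =
    reduced x y λ _ → mk⇔ (closedNbhd-transfer twins) (closedNbhd-transfer (EndpointTwins-sym twins))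

module EndpointSequence {p} (I : Fin p → Interval) (isInterval : ∀ x → IsInterval (I x))
  (e : Fin (p + p) ⤖ (Fin p × Bool))
  (increasing : ∀ k k' → k <ᶠ k' →
                endpoint I (Bijection.to e k) < endpoint I (Bijection.to e k')) where

  open Bijection e using (to; injective; strictlySurjective)

  vertex : Fin (p + p) → Fin p
  vertex k = proj₁ (to k)

  tag : Fin (p + p) → Bool
  tag k = proj₂ (to k)

  value : Fin (p + p) → ℕ
  value k = endpoint I (to k)

  position : Fin p × Bool → Fin (p + p)
  position c = proj₁ (strictlySurjective c)

  to-position : ∀ c → to (position c) ≡ c
  to-position c = proj₂ (strictlySurjective c)

  tag-position : ∀ c → tag (position c) ≡ proj₂ c
  tag-position c = cong proj₂ (to-position c)

  value-tagged : ∀ {k b} → tag k ≡ b → value k ≡ endpoint I (vertex k , b)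
  value-tagged {k} = cong (λ b → endpoint I (vertex k , b))

  value-<⇒position-< : ∀ {k k'} → value k < value k' → toℕ k < toℕ k'
  value-<⇒position-< {k} {k'} v<v' with <-cmp (toℕ k) (toℕ k')
  ... | tri< k<k' _ _ = k<k'
  ... | tri≈ _ k≡k' _ = ⊥-elim (<-irrefl (cong value (toℕ-injective k≡k')) v<v')
  ... | tri> _ _ k'<k = ⊥-elim (<-asym v<v' (increasing k' k k'<k))

  value-between⇒position-between : ∀ {j k k'} → StrictlyBetween (value j) (value k) (value k') →
                                   StrictlyBetween (toℕ j) (toℕ k) (toℕ k')
  value-between⇒position-between (inj₁ (k<j , j<k')) = inj₁ (value-<⇒position-< k<j , value-<⇒position-< j<k')
  value-between⇒position-between (inj₂ (k'<j , j<k)) = inj₂ (value-<⇒position-< k'<j , value-<⇒position-< j<k)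

  position-between : ∀ {k k'} c → StrictlyBetween (endpoint I c) (value k) (value k') →
                     StrictlyBetween (toℕ (position c)) (toℕ k) (toℕ k')
  position-between c between =
    value-between⇒position-between
      (subst (λ t → StrictlyBetween t _ _) (sym (cong (endpoint I) (to-position c))) between)

  same-entry : ∀ {k k'} → vertex k ≡ vertex k' → tag k ≡ tag k' → k ≡ k'
  same-entry same t = injective (cong₂ _,_ same t)

  earlier-occurrence-is-left : ∀ {k k'} → toℕ k < toℕ k' → vertex k ≡ vertex k' →
                               tag k ≡ true × tag k' ≡ false
  earlier-occurrence-is-left {k} {k'} k<k' same with tag k in tk | tag k' in tk'
  ... | true  | false = refl , refl
  ... | true  | true  = ⊥-elim (<-irrefl (cong toℕ (same-entry same (trans tk (sym tk')))) k<k')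
  ... | false | false = ⊥-elim (<-irrefl (cong toℕ (same-entry same (trans tk (sym tk')))) k<k')
  ... | false | true  = ⊥-elim (<⇒≱ right<left (isInterval (vertex k)))
    where
      right<left : right (I (vertex k)) < left (I (vertex k))
      right<left = subst₂ _<_ (value-tagged tk) (trans (value-tagged tk') (cong (left ∘ I) (sym same)))
                          (increasing k k' k<k')

  module _ {Nb : Fin p → Set} {s₁ l₁ s₂ l₂ : ℕ}
    (run₁ : Covers vertex Nb s₁ l₁) (run₂ : Covers vertex Nb s₂ l₂)
    (run₁≺run₂ : s₁ + l₁ ≤ s₂) where

    precedes : ∀ {k j : Fin (p + p)} → InRange s₁ l₁ k → InRange s₂ l₂ j → toℕ k < toℕ j
    precedes (_ , k<s₁+l₁) (s₂≤j , _) = <-≤-trans k<s₁+l₁ (≤-trans run₁≺run₂ s₂≤j)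

    first-run-left : ∀ {k : Fin (p + p)} → InRange s₁ l₁ k → tag k ≡ true
    first-run-left {k} rk =
      let (j , rj , vj) = proj₂ run₂ (vertex k) (proj₁ run₁ k rk)
      in proj₁ (earlier-occurrence-is-left (precedes rk rj) (sym vj))

    second-run-right : ∀ {j : Fin (p + p)} → InRange s₂ l₂ j → tag j ≡ false
    second-run-right {j} rj =
      let (k , rk , vk) = proj₂ run₁ (vertex j) (proj₁ run₂ j rj)
      in proj₂ (earlier-occurrence-is-left (precedes rk rj) vk)

    right-partner : ∀ {k} → InRange s₁ l₁ k →
                    ∃[ j ] (InRange s₂ l₂ j × value j ≡ right (I (vertex k)))
    right-partner {k} rk =
      let (j , rj , vj) = proj₂ run₂ (vertex k) (proj₁ run₁ k rk)
      in j , rj , trans (value-tagged (second-run-right rj)) (cong (right ∘ I) vj)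

    consecutive-twins : ∀ {k k'} → InRange s₁ l₁ k → InRange s₁ l₁ k' → toℕ k' ≡ suc (toℕ k) →
                        EndpointTwins I (vertex k) (vertex k')
    consecutive-twins {k} {k'} rk rk' k'≡1+k = noRight , noLeft
      where
        noRight : ∀ z → ¬ StrictlyBetween (right (I z)) (left (I (vertex k))) (left (I (vertex k')))
        noRight z between =
          ¬StrictlyBetween-suc (subst (StrictlyBetween _ (toℕ k)) k'≡1+k
            (position-between (z , false)
              (subst₂ (StrictlyBetween _) (sym (value-tagged (first-run-left rk)))
                                          (sym (value-tagged (first-run-left rk'))) between)))

        noLeft : ∀ z → ¬ StrictlyBetween (left (I z)) (right (I (vertex k))) (right (I (vertex k')))
        noLeft z between =
          let (j , rj , vj) = right-partner rk
              (j' , rj' , vj') = right-partner rk'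
              inSecondRun = inRange-between rj rj'
                (position-between (z , true) (subst₂ (StrictlyBetween _) (sym vj) (sym vj') between))
          in true≢false (trans (sym (tag-position (z , true))) (second-run-right inSecondRun))

    first-run-short : ∀ {A} → (∀ x y → x ≢ y → (A x y ⇔ Intersect (I x) (I y))) →
                      (∀ x y → left (I x) ≢ right (I y)) → Reduced A →
                      s₁ + l₁ ≤ p + p → l₁ ≤ 1
    first-run-short adj⇔intersect distinctEnds reduced bound = ≮⇒≥ λ 1<l₁ →
      let (k , k' , rk , rk' , k'≡1+k) = leading-pair 1<l₁ bound
          k<k' = subst (toℕ k <_) (sym k'≡1+k) (n<1+n (toℕ k))
          same = IntervalTwins.twins-equal isInterval adj⇔intersect distinctEnds reduced
                   (consecutive-twins rk rk' k'≡1+k)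
      in true≢false (trans (sym (first-run-left rk')) (proj₂ (earlier-occurrence-is-left k<k' same)))

earlier-perfect-substring-short :
  ∀ {p q} (G : SimpleGraph (Vertex p q)) → Reduced (ProbeAdj G) →
  ∀ {S} → IsCanonicalSequence (ProbeAdj G) S →
  ∀ {w s l s' l'} → IsPerfectSubstring G S w s l → IsPerfectSubstring G S w s' l' → s + l ≤ s' → l ≤ 1
earlier-perfect-substring-short G reduced
  (_ , I , ((isInterval , adj⇔intersect , _) , distinctEnds , _) , e , S≗vertex , increasing)
  (bound , perfect) (_ , perfect') s+l≤s' =
  first-run-short (Covers-cong S≗vertex perfect) (Covers-cong S≗vertex perfect') s+l≤s'
                  adj⇔intersect distinctEnds reduced bound
  where open EndpointSequence I isInterval e increasing

proposition3p8 : ∀ {p q} (G : SimpleGraph (Vertex p q)) →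
    IsProperTaggedProbeIntervalGraph G →
    Connected (ProbeAdj G) →
    Reduced (ProbeAdj G) →
    (S : Fin (p + p) → Fin p) → IsCanonicalSequence (ProbeAdj G) S →
    (w : Fin q) →
    ¬ (∃[ s1 ] ∃[ l1 ] ∃[ s2 ] ∃[ l2 ]
    (IsPerfectSubstring G S w s1 l1 × IsPerfectSubstring G S w s2 l2 ×
    1 < l1 × 1 < l2 × DisjointRanges s1 l1 s2 l2))
proposition3p8 G _ _ reduced S canonical w (_ , _ , _ , _ , sub₁ , sub₂ , 1<l₁ , _ , inj₁ sub₁≺sub₂) =
  <⇒≱ 1<l₁ (earlier-perfect-substring-short G reduced canonical sub₁ sub₂ sub₁≺sub₂)
proposition3p8 G _ _ reduced S canonical w (_ , _ , _ , _ , sub₁ , sub₂ , _ , 1<l₂ , inj₂ sub₂≺sub₁) =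
  <⇒≱ 1<l₂ (earlier-perfect-substring-short G reduced canonical sub₂ sub₁ sub₂≺sub₁)
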